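{- Let $n>1$ and $m$ be integers with $0\le m\le n$. Then the map $\mathcal{F}_n^m\to\mathcal{G}_n^{n-m}$, $\tfrac{h}{k}\mapsto\tfrac{k-h}{k}$, and the map $\mathcal{G}_n^m\to\mathcal{F}_n^{n-m}$, $\tfrac{h}{k}\mapsto\tfrac{k-h}{k}$, are both well defined, order-reversing and bijective.
   Context: For an integer $n\ge1$, the Farey sequence $\mathcal{F}_n$ is the ascending sequence of all irreducible fractions $\tfrac{h}{k}\in\mathbb{Q}$ (with $h\ge0$, $k\ge1$, $\gcd(h,k)=1$) such that $\tfrac{0}{1}\le\tfrac{h}{k}\le\tfrac{1}{1}$ and $1\le k\le n$. For an integer $p$, $\mathcal{F}_n^p$ denotes the subsequence $(\tfrac{h}{k}\in\mathcal{F}_n:\ h\le p)$, and $\mathcal{G}_n^p$ denotes the subsequence $(\tfrac{h}{k}\in\mathcal{F}_n:\ k-h\le n-p)$, where each fraction is written in lowest terms. All sequences are ordered by the usual order of rationals. -}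

module Defs where

open import Data.Nat using (ℕ; _+_; _*_; _∸_; _≤_; _<_)
open import Data.Nat.Coprimality using (Coprime)
open import Data.Product using (_×_)

record Frac : Set where
  constructor _//_
  field
    num : ℕ
    den : ℕ
open Frac public

InFarey : ℕ → Frac → Set
InFarey n x = Coprime (num x) (den x) × 1 ≤ den x × den x ≤ n × num x ≤ den x

InF : ℕ → ℕ → Frac → Set
InF n p x = InFarey n x × num x ≤ p

-- 𝓖_n^p : elements of 𝓕_n with k - h ≤ n - p
-- (used only with p ≤ n and num ≤ den, so truncated subtraction is exact)
InG : ℕ → ℕ → Frac → Set
InG n p x = InFarey n x × den x ∸ num x ≤ n ∸ p

reflect : Frac → Frac
reflect x = (den x ∸ num x) // den x

-- the usual order of rationals on fractions with positive denominators
_<F_ : Frac → Frac → Set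
x <F y = num x * den y < num y * den x

WellDefined : (Frac → Set) → (Frac → Set) → Set
WellDefined A B = ∀ x → A x → B (reflect x)

OrderReversing : (Frac → Set) → Set
OrderReversing A = ∀ x y → A x → A y → x <F y → reflect y <F reflect x

InjectiveOn : (Frac → Set) → Set
InjectiveOn A = ∀ x y → A x → A y → reflect x ≡ reflect y → x ≡ y
  where open import Relation.Binary.PropositionalEquality using (_≡_)

SurjectiveOnto : (Frac → Set) → (Frac → Set) → Set
SurjectiveOnto A B = ∀ y → B y → Σ Frac (λ x → A x × reflect x ≡ y)
  where open import Relation.Binary.PropositionalEquality using (_≡_)
        open import Data.Product using (Σ)

{-# OPTIONS --safe #-}
module Submission where

open import Defs
open import Data.Nat using (ℕ; _≤_; _<_; _∸_; _*_)
open import Data.Nat.Properties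
open import Data.Nat.Divisibility using (_∣_; ∣m+n∣m⇒∣n)
open import Data.Nat.Coprimality using (Coprime)
open import Data.Product using (_×_; _,_; proj₁)
open import Relation.Binary.PropositionalEquality

-- The reflection h/k ↦ (k-h)/k is an involution on 𝓕_n; the conditions h ≤ p and
-- k - h ≤ n - q are swapped by it exactly when p + q = n, which gives the bijections.

coprime-∸ : ∀ {h k} → h ≤ k → Coprime h k → Coprime (k ∸ h) k
coprime-∸ {h} {k} h≤k coprime {d} (d∣k∸h , d∣k) =
  coprime (∣m+n∣m⇒∣n (subst (d ∣_) (sym (m∸n+n≡m h≤k)) d∣k) d∣k∸h , d∣k)

reflect-InFarey : ∀ {n x} → InFarey n x → InFarey n (reflect x)
reflect-InFarey {x = h // k} (coprime , 1≤k , k≤n , h≤k) =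
  coprime-∸ h≤k coprime , 1≤k , k≤n , m∸n≤m k h

reflect-involutive : ∀ {x} → num x ≤ den x → reflect (reflect x) ≡ x
reflect-involutive {h // k} h≤k = cong (_// k) (m∸[m∸n]≡n h≤k)

reflect-injective : ∀ {x y} → num x ≤ den x → num y ≤ den y → reflect x ≡ reflect y → x ≡ y
reflect-injective {x} {y} hx hy eq = begin
  x                   ≡⟨ reflect-involutive hx ⟨
  reflect (reflect x) ≡⟨ cong reflect eq ⟩
  reflect (reflect y) ≡⟨ reflect-involutive hy ⟩
  y                   ∎
  where open ≡-Reasoning

-- (k' - h') k = k' k - h' k < k k' - h k' = (k - h) k', the subtraction being
-- strictly monotone since h k' < h' k ≤ k' k.
reflect-reverses-<F : ∀ {x y} → num y ≤ den y → x <F y → reflect y <F reflect x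
reflect-reverses-<F {h // k} {h' // k'} h'≤k' hk'<h'k =
  subst₂ _<_ (sym (*-distribʳ-∸ k k' h')) (sym (*-distribʳ-∸ k' k h))
    (subst (λ z → k' * k ∸ h' * k < z ∸ h * k') (*-comm k' k)
      (∸-monoʳ-< hk'<h'k (*-monoˡ-≤ k h'≤k')))

num≤den : ∀ {n x} → InFarey n x → num x ≤ den x
num≤den (_ , _ , _ , h≤k) = h≤k

reflect-InF : ∀ {n} p q {x} → n ∸ q ≡ p → InF n p x → InG n q (reflect x)
reflect-InF p q {h // k} n∸q≡p (farey@(_ , _ , _ , h≤k) , h≤p) =
  reflect-InFarey farey ,
  subst₂ _≤_ (sym (m∸[m∸n]≡n h≤k)) (sym n∸q≡p) h≤p

reflect-InG : ∀ {n} p q {x} → n ∸ q ≡ p → InG n q x → InF n p (reflect x)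
reflect-InG p q n∸q≡p (farey , k∸h≤n∸q) =
  reflect-InFarey farey , subst (_ ≤_) n∸q≡p k∸h≤n∸q

reflect-bijective : ∀ {n} {A B : Frac → Set} →
  (∀ {x} → A x → InFarey n x) → (∀ {y} → B y → InFarey n y) →
  WellDefined A B → WellDefined B A →
  WellDefined A B × OrderReversing A × InjectiveOn A × SurjectiveOnto A B
reflect-bijective A⊆𝓕 B⊆𝓕 A→B B→A =
  A→B ,
  (λ x y Ax Ay → reflect-reverses-<F {x} {y} (num≤den (A⊆𝓕 Ay))) ,
  (λ x y Ax Ay → reflect-injective (num≤den (A⊆𝓕 Ax)) (num≤den (A⊆𝓕 Ay))) ,
  (λ y By → reflect y , B→A y By , reflect-involutive (num≤den (B⊆𝓕 By)))

lemma1 : (n m : ℕ) → 1 < n → m ≤ n →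
    (WellDefined (InF n m) (InG n (n ∸ m)) × OrderReversing (InF n m)
      × InjectiveOn (InF n m) × SurjectiveOnto (InF n m) (InG n (n ∸ m)))
    × (WellDefined (InG n m) (InF n (n ∸ m)) × OrderReversing (InG n m)
      × InjectiveOn (InG n m) × SurjectiveOnto (InG n m) (InF n (n ∸ m)))
lemma1 n m _ m≤n =
  reflect-bijective proj₁ proj₁
    (λ _ → reflect-InF m (n ∸ m) n∸[n∸m]≡m) (λ _ → reflect-InG m (n ∸ m) n∸[n∸m]≡m) ,
  reflect-bijective proj₁ proj₁
    (λ _ → reflect-InG (n ∸ m) m refl) (λ _ → reflect-InF (n ∸ m) m refl)
  where
  n∸[n∸m]≡m : n ∸ (n ∸ m) ≡ m
  n∸[n∸m]≡m = m∸[m∸n]≡n m≤n
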